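{- Consider the extension of $\mathsf{C}\text{ - }\mathsf{RASP}$ with an additional count-valued operation $C(i):=\#_2[j\le i]\,F(i,j)$, whose value at position $i$ is the number of $j\in[1,i]$ for which $F(i,j)$ holds, where $F$ is a Boolean combination of values $P_1(i),\dots,P_k(i),P_1(j),\dots,P_k(j)$ of earlier Boolean-valued operations $P_1,\dots,P_k$ evaluated at $i$ and at $j$. Every program of this extended language is equivalent to a $\mathsf{C}\text{ - }\mathsf{RASP}$ program using only the ordinary counting operation, i.e., there is an ordinary $\mathsf{C}\text{ - }\mathsf{RASP}$ program that accepts exactly the same input strings.
   Context: A $\mathsf{C}\text{ - }\mathsf{RASP}$ program over a finite alphabet $\Sigma$ is a finite sequence of operations, each defining either a Boolean-valued sequence $P(i)$ or integer-valued sequence $C(i)$ over positions $i\in[1,n]$ of an input $w=w_1\cdots w_n$ ($n\ge1$), in terms of earlier operations. Boolean-valued: $P(i):=Q_a(i)$ for $a\in\Sigma$ (true iff $w_i=a$), $\lnot P_1(i)$, $P_1(i)\land P_2(i)$, $C_1(i)\le C_2(i)$, $1$ (true). Count-valued: the ordinary counting operation $C(i):=\#[j\le i]\,P(j)$ (the number of $j\in[1,i]$ with $P(j)$ true), the conditional $P(i)\,?\,C_1(i):C_2(i)$ ($C_1(i)$ if $P(i)$ is true, else $C_2(i)$), $C_1(i)+C_2(i)$, $C_1(i)-C_2(i)$, $\min(C_1(i),C_2(i))$, $\max(C_1(i),C_2(i))$, $1$. The last operation must be Boolean-valued; the program accepts $w$ iff that operation is true at position $n$. -}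

module Defs where

open import Data.Bool using (Bool; true; false; not; _∧_; if_then_else_)
open import Data.Nat using (ℕ; zero; suc; _≤ᵇ_)
open import Data.Integer using (ℤ; +_; _+_; _-_; _⊓_; _⊔_) renaming (_≤ᵇ_ to _≤ᶻ_)
open import Data.Fin using (Fin; toℕ; _≟_) renaming (fromℕ to lastFin)
open import Data.List using (List; []; _∷_; map; allFin)
open import Data.Nat.ListAction using (sum)
open import Data.Vec using (Vec; lookup)
open import Relation.Nullary.Decidable using (⌊_⌋)

data Sort : Set where
  bool count : Sort

-- Context: the sorts of the earlier operations, most recent first.
Ctx : Set
Ctx = List Sort

data _∋_ : Ctx → Sort → Set where
  here  : ∀ {Γ s} → (s ∷ Γ) ∋ s
  there : ∀ {Γ s t} → Γ ∋ s → (t ∷ Γ) ∋ s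

data BF (Γ : Ctx) : Set where
  atI  : Γ ∋ bool → BF Γ
  atJ  : Γ ∋ bool → BF Γ
  bnot : BF Γ → BF Γ
  band : BF Γ → BF Γ → BF Γ

-- Operations over alphabet Fin m.  The flag e says whether the extended
-- two-index counting operation #₂ is allowed (e = true) or not (e = false).
data Op (m : ℕ) : Bool → Ctx → Sort → Set where
  Q     : ∀ {e Γ} → Fin m → Op m e Γ bool
  ¬'    : ∀ {e Γ} → Γ ∋ bool → Op m e Γ bool
  ∧'    : ∀ {e Γ} → Γ ∋ bool → Γ ∋ bool → Op m e Γ bool
  ≤'    : ∀ {e Γ} → Γ ∋ count → Γ ∋ count → Op m e Γ bool
  tt'   : ∀ {e Γ} → Op m e Γ bool
  #'    : ∀ {e Γ} → Γ ∋ bool → Op m e Γ count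
  cond  : ∀ {e Γ} → Γ ∋ bool → Γ ∋ count → Γ ∋ count → Op m e Γ count
  plus  : ∀ {e Γ} → Γ ∋ count → Γ ∋ count → Op m e Γ count
  minus : ∀ {e Γ} → Γ ∋ count → Γ ∋ count → Op m e Γ count
  min'  : ∀ {e Γ} → Γ ∋ count → Γ ∋ count → Op m e Γ count
  max'  : ∀ {e Γ} → Γ ∋ count → Γ ∋ count → Op m e Γ count
  one   : ∀ {e Γ} → Op m e Γ count
  #₂    : ∀ {Γ} → BF Γ → Op m true Γ count

data Ops (m : ℕ) (e : Bool) : Ctx → Set where
  []  : Ops m e []
  _▷_ : ∀ {Γ s} → Ops m e Γ → Op m e Γ s → Ops m e (s ∷ Γ)

record Program (m : ℕ) (e : Bool) : Set where
  constructor prog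
  field
    {ctx} : Ctx
    body  : Ops m e ctx
    final : Op m e ctx bool

CRASP : ℕ → Set
CRASP m = Program m false

ExtCRASP : ℕ → Set
ExtCRASP m = Program m true

-- Semantics on an input word w of length n (positions Fin n, 0-based;
-- position j ≤ i in 0-based terms corresponds to [1,i] in 1-based terms).

Val : Sort → Set
Val bool  = Bool
Val count = ℤ

data Env (n : ℕ) : Ctx → Set where
  []  : Env n []
  _∷_ : ∀ {Γ s} → (Fin n → Val s) → Env n Γ → Env n (s ∷ Γ)

get : ∀ {n Γ s} → Env n Γ → Γ ∋ s → Fin n → Val s
get (v ∷ ρ) here      = v
get (v ∷ ρ) (there x) = get ρ x

countUpTo : ∀ {n} → (Fin n → Bool) → Fin n → ℕ
countUpTo {n} p i = sum (map (λ j → if (toℕ j ≤ᵇ toℕ i) ∧ p j then 1 else 0) (allFin n))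

evalBF : ∀ {n Γ} → Env n Γ → BF Γ → Fin n → Fin n → Bool
evalBF ρ (atI x)    i j = get ρ x i
evalBF ρ (atJ x)    i j = get ρ x j
evalBF ρ (bnot f)   i j = not (evalBF ρ f i j)
evalBF ρ (band f g) i j = evalBF ρ f i j ∧ evalBF ρ g i j

evalOp : ∀ {m e n Γ s} → Vec (Fin m) n → Env n Γ → Op m e Γ s → Fin n → Val s
evalOp w ρ (Q a)         i = ⌊ lookup w i ≟ a ⌋
evalOp w ρ (¬' p)        i = not (get ρ p i)
evalOp w ρ (∧' p q)      i = get ρ p i ∧ get ρ q i
evalOp w ρ (≤' c d)      i = get ρ c i ≤ᶻ get ρ d i
evalOp w ρ tt'           i = true
evalOp w ρ (#' p)        i = + countUpTo (get ρ p) i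
evalOp w ρ (cond p c d)  i = if get ρ p i then get ρ c i else get ρ d i
evalOp w ρ (plus c d)    i = get ρ c i + get ρ d i
evalOp w ρ (minus c d)   i = get ρ c i - get ρ d i
evalOp w ρ (min' c d)    i = get ρ c i ⊓ get ρ d i
evalOp w ρ (max' c d)    i = get ρ c i ⊔ get ρ d i
evalOp w ρ one           i = + 1
evalOp w ρ (#₂ f)        i = + countUpTo (evalBF ρ f i) i

evalOps : ∀ {m e n Γ} → Vec (Fin m) n → Ops m e Γ → Env n Γ
evalOps w []       = []
evalOps w (os ▷ o) = let ρ = evalOps w os in evalOp w ρ o ∷ ρ

accepts : ∀ {m e k} → Program m e → Vec (Fin m) (suc k) → Bool
accepts {k = k} (prog body final) w = evalOp w (evalOps w body) final (lastFin k)

{-# OPTIONS --safe #-}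
module Submission where

open import Defs
open import Data.Bool using (Bool; true; false; not; _∧_; if_then_else_)
open import Data.Bool.Properties using (if-float; if-cong; if-cong₂)
open import Data.Fin using (Fin; toℕ) renaming (fromℕ to lastFin)
open import Data.Integer using (+_; _+_; _-_; _⊓_; _⊔_) renaming (_≤ᵇ_ to _≤ᶻ_)
open import Data.List using (map; allFin)
open import Data.List.Properties using (map-cong)
open import Data.Nat using (ℕ; suc; _≤ᵇ_)
open import Data.Nat.ListAction using (sum)
open import Data.Product using (Σ; _,_)
open import Data.Vec using (Vec)
open import Relation.Binary.PropositionalEquality using (_≡_; _≗_; refl; sym; trans; cong; cong₂)

-- A pair count #₂[j ≤ i] F(i,j) is, for each fixed i, an ordinary count of
-- the j-formula obtained by substituting the values P(i) into F.  Expanding F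
-- over its i-atoms gives a finite case tree whose leaves are formulas in j
-- alone; each leaf is an ordinary C-RASP count, and the tree is evaluated by
-- nested conditionals on the P(i).  Translating a program operation by
-- operation in this way yields an equivalent ordinary program.

private
  variable
    n : ℕ
    e : Bool
    Γ Δ : Ctx
    s : Sort

countUpTo-cong : {p q : Fin n → Bool} → p ≗ q → countUpTo p ≗ countUpTo q
countUpTo-cong {n} p≗q i =
  cong sum (map-cong (λ j → cong (λ b → if (toℕ j ≤ᵇ toℕ i) ∧ b then 1 else 0) (p≗q j)) (allFin n))

data JFormula (Γ : Ctx) : Set where
  jvar  : Γ ∋ bool → JFormula Γ
  jtrue : JFormula Γ
  jnot  : JFormula Γ → JFormula Γ
  jand  : JFormula Γ → JFormula Γ → JFormula Γ

evalJ : Env n Γ → JFormula Γ → Fin n → Bool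
evalJ ρ (jvar x)    j = get ρ x j
evalJ ρ jtrue       j = true
evalJ ρ (jnot h)    j = not (evalJ ρ h j)
evalJ ρ (jand h h′) j = evalJ ρ h j ∧ evalJ ρ h′ j

data CaseTree (Γ : Ctx) : Set where
  leaf   : JFormula Γ → CaseTree Γ
  branch : Γ ∋ bool → CaseTree Γ → CaseTree Γ → CaseTree Γ

leafAt : Env n Γ → CaseTree Γ → Fin n → JFormula Γ
leafAt ρ (leaf h)       i = h
leafAt ρ (branch x t u) i = if get ρ x i then leafAt ρ t i else leafAt ρ u i

_>>=_ : CaseTree Γ → (JFormula Γ → CaseTree Γ) → CaseTree Γ
leaf h       >>= k = k h
branch x t u >>= k = branch x (t >>= k) (u >>= k)

leafAt->>= : (ρ : Env n Γ) (t : CaseTree Γ) (k : JFormula Γ → CaseTree Γ) (i : Fin n) →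
             leafAt ρ (t >>= k) i ≡ leafAt ρ (k (leafAt ρ t i)) i
leafAt->>= ρ (leaf h)       k i = refl
leafAt->>= ρ (branch x t u) k i with get ρ x i
... | true  = leafAt->>= ρ t k i
... | false = leafAt->>= ρ u k i

caseTree : BF Γ → CaseTree Γ
caseTree (atI x)    = branch x (leaf jtrue) (leaf (jnot jtrue))
caseTree (atJ x)    = leaf (jvar x)
caseTree (bnot f)   = caseTree f >>= λ h → leaf (jnot h)
caseTree (band f g) = caseTree f >>= λ h → caseTree g >>= λ h′ → leaf (jand h h′)

caseTree-sound : (ρ : Env n Γ) (f : BF Γ) (i j : Fin n) →
                 evalJ ρ (leafAt ρ (caseTree f) i) j ≡ evalBF ρ f i j
caseTree-sound ρ (atI x) i j with get ρ x i
... | true  = refl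
... | false = refl
caseTree-sound ρ (atJ x) i j = refl
caseTree-sound ρ (bnot f) i j
  rewrite leafAt->>= ρ (caseTree f) (λ h → leaf (jnot h)) i
  = cong not (caseTree-sound ρ f i j)
caseTree-sound ρ (band f g) i j
  rewrite leafAt->>= ρ (caseTree f) (λ h → caseTree g >>= λ h′ → leaf (jand h h′)) i
        | leafAt->>= ρ (caseTree g) (λ h′ → leaf (jand (leafAt ρ (caseTree f) i) h′)) i
  = cong₂ _∧_ (caseTree-sound ρ f i j) (caseTree-sound ρ g i j)

module Translation (m : ℕ) where

  Meaning : Ctx → Set
  Meaning Γ = ∀ {n} → Vec (Fin m) n → Env n Γ

  meaning : Ops m e Γ → Meaning Γ
  meaning os w = evalOps w os

  Sequence : Sort → Set
  Sequence s = ∀ {n} → Vec (Fin m) n → Fin n → Val s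

  record Computed (os : Ops m false Δ) (f : Sequence s) : Set where
    constructor computed
    field
      var  : Δ ∋ s
      var≡ : ∀ {n} (w : Vec (Fin m) n) i → get (evalOps w os) var i ≡ f w i
  open Computed

  record Realises (os : Ops m false Δ) (ρ : Meaning Γ) : Set where
    constructor realising
    field
      realise : ∀ {s} (x : Γ ∋ s) → Computed os (λ w → get (ρ w) x)
  open Realises

  rename : {os : Ops m false Δ} {ρ : Meaning Γ} → Realises os ρ → Γ ∋ s → Δ ∋ s
  rename R x = var (realise R x)

  rename-sound : {os : Ops m false Δ} {ρ : Meaning Γ} (R : Realises os ρ) (x : Γ ∋ s) →
                 ∀ {n} (w : Vec (Fin m) n) i → get (evalOps w os) (rename R x) i ≡ get (ρ w) x i
  rename-sound R x = var≡ (realise R x)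

  _⊑_ : ∀ {Δ′} → Ops m false Δ → Ops m false Δ′ → Set
  os ⊑ os′ = Realises os′ (meaning os)

  ⊑-refl : {os : Ops m false Δ} → os ⊑ os
  ⊑-refl = realising λ x → computed x (λ w i → refl)

  ⊑-▷ : {os : Ops m false Δ} {o : Op m false Δ s} → os ⊑ (os ▷ o)
  ⊑-▷ = realising λ x → computed (there x) (λ w i → refl)

  carry : ∀ {Δ′} {os : Ops m false Δ} {os′ : Ops m false Δ′} {f : Sequence s} →
          os ⊑ os′ → Computed os f → Computed os′ f
  carry os⊑os′ (computed x x≡) = let computed y y≡ = realise os⊑os′ x in
    computed y (λ w i → trans (y≡ w i) (x≡ w i))

  realises-⊑ : ∀ {Δ′} {os : Ops m false Δ} {os′ : Ops m false Δ′} {ρ : Meaning Γ} →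
               os ⊑ os′ → Realises os ρ → Realises os′ ρ
  realises-⊑ os⊑os′ R = realising λ x → carry os⊑os′ (realise R x)

  record Extension (os : Ops m false Δ) (f : Sequence s) : Set where
    field
      {Δ′}    : Ctx
      ops     : Ops m false Δ′
      extends : os ⊑ ops
      value   : Computed ops f
  open Extension

  emit : {os : Ops m false Δ} {f : Sequence s} (o : Op m false Δ s) →
         (∀ {n} (w : Vec (Fin m) n) i → evalOp w (evalOps w os) o i ≡ f w i) → Extension os f
  emit o o≡ = record { ops = _ ▷ o ; extends = ⊑-▷ ; value = computed here o≡ }

  retarget : {os : Ops m false Δ} {f g : Sequence s} →
             (∀ {n} (w : Vec (Fin m) n) i → f w i ≡ g w i) → Extension os f → Extension os g
  retarget f≡g E = record
    { ops     = ops E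
    ; extends = extends E
    ; value   = computed (var a) (λ w i → trans (var≡ a w i) (f≡g w i))
    }
    where a = value E

  infixr 4 _>>>_
  _>>>_ : ∀ {t} {os : Ops m false Δ} {f : Sequence s} {g : Sequence t} →
          (E : Extension os f) → Extension (ops E) g → Extension os g
  E >>> E′ = record
    { ops     = ops E′
    ; extends = realises-⊑ (extends E′) (extends E)
    ; value   = value E′
    }

  compileJ : {os : Ops m false Δ} {ρ : Meaning Γ} → Realises os ρ →
             (h : JFormula Γ) → Extension os (λ w → evalJ (ρ w) h)
  compileJ R (jvar x)    = record { ops = _ ; extends = ⊑-refl ; value = realise R x }
  compileJ R jtrue       = emit tt' (λ w i → refl)
  compileJ R (jnot h)    = E >>> emit (¬' (var a)) (λ w i → cong not (var≡ a w i))
    where E = compileJ R h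
          a = value E
  compileJ R (jand h h′) =
    E >>> E′ >>> emit (∧' (var a) (var b)) (λ w i → cong₂ _∧_ (var≡ a w i) (var≡ b w i))
    where E  = compileJ R h
          E′ = compileJ (realises-⊑ (extends E) R) h′
          a  = carry (extends E′) (value E)
          b  = value E′

  compileTree : {os : Ops m false Δ} {ρ : Meaning Γ} → Realises os ρ → (t : CaseTree Γ) →
                Extension os (λ w i → + countUpTo (evalJ (ρ w) (leafAt (ρ w) t i)) i)
  compileTree R (leaf h) =
    E >>> emit (#' (var a)) (λ w i → cong +_ (countUpTo-cong (var≡ a w) i))
    where E = compileJ R h
          a = value E
  compileTree {ρ = ρ} R (branch x t u) =
    E >>> E′ >>> emit (cond (var p) (var a) (var b)) (λ w i →
      trans (trans (if-cong (var≡ p w i)) (if-cong₂ _ (var≡ a w i) (var≡ b w i)))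
            (sym (if-float (λ h → + countUpTo (evalJ (ρ w) h) i) (get (ρ w) x i))))
    where E  = compileTree R t
          E′ = compileTree (realises-⊑ (extends E) R) u
          p  = carry (extends E′) (carry (extends E) (realise R x))
          a  = carry (extends E′) (value E)
          b  = value E′

  renameBool : {os : Ops m false Δ} {ρ : Meaning Γ} →
               Realises os ρ → Op m e Γ bool → Op m false Δ bool
  renameBool R (Q a)    = Q a
  renameBool R (¬' p)   = ¬' (rename R p)
  renameBool R (∧' p q) = ∧' (rename R p) (rename R q)
  renameBool R (≤' c d) = ≤' (rename R c) (rename R d)
  renameBool R tt'      = tt'

  renameBool-sound : {os : Ops m false Δ} {ρ : Meaning Γ} (R : Realises os ρ) (o : Op m e Γ bool) →
                     ∀ {n} (w : Vec (Fin m) n) i →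
                     evalOp w (evalOps w os) (renameBool R o) i ≡ evalOp w (ρ w) o i
  renameBool-sound R (Q a)    w i = refl
  renameBool-sound R (¬' p)   w i = cong not (rename-sound R p w i)
  renameBool-sound R (∧' p q) w i = cong₂ _∧_ (rename-sound R p w i) (rename-sound R q w i)
  renameBool-sound R (≤' c d) w i = cong₂ _≤ᶻ_ (rename-sound R c w i) (rename-sound R d w i)
  renameBool-sound R tt'      w i = refl

  translateOp : {os : Ops m false Δ} {ρ : Meaning Γ} → Realises os ρ →
                (o : Op m e Γ s) → Extension os (λ w → evalOp w (ρ w) o)
  translateOp {s = bool} R o = emit (renameBool R o) (renameBool-sound R o)
  translateOp R (#' p) =
    emit (#' (rename R p))
         (λ w i → cong +_ (countUpTo-cong (rename-sound R p w) i))
  translateOp R (cond p c d) =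
    emit (cond (rename R p) (rename R c) (rename R d))
         (λ w i → trans (if-cong (rename-sound R p w i))
                         (if-cong₂ _ (rename-sound R c w i) (rename-sound R d w i)))
  translateOp R (plus c d) =
    emit (plus (rename R c) (rename R d))
         (λ w i → cong₂ _+_ (rename-sound R c w i) (rename-sound R d w i))
  translateOp R (minus c d) =
    emit (minus (rename R c) (rename R d))
         (λ w i → cong₂ _-_ (rename-sound R c w i) (rename-sound R d w i))
  translateOp R (min' c d) =
    emit (min' (rename R c) (rename R d))
         (λ w i → cong₂ _⊓_ (rename-sound R c w i) (rename-sound R d w i))
  translateOp R (max' c d) =
    emit (max' (rename R c) (rename R d))
         (λ w i → cong₂ _⊔_ (rename-sound R c w i) (rename-sound R d w i))
  translateOp R one = emit one (λ w i → refl)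
  translateOp {ρ = ρ} R (#₂ f) =
    retarget (λ w i → cong +_ (countUpTo-cong (caseTree-sound (ρ w) f i) i))
             (compileTree R (caseTree f))

  record Translated (src : Ops m true Γ) : Set where
    field
      {ctx}    : Ctx
      target   : Ops m false ctx
      realises : Realises target (meaning src)
  open Translated public

  translate : (src : Ops m true Γ) → Translated src
  translate []        = record { target = [] ; realises = realising λ () }
  translate (src ▷ o) = record
    { target   = ops E
    ; realises = realising λ { here → value E ; (there x) → carry (extends E) (realise R x) }
    }
    where R = realises (translate src)
          E = translateOp R o

lemma6 : (m : ℕ) (P : ExtCRASP m) →
    Σ (CRASP m) (λ P′ → (k : ℕ) (w : Vec (Fin m) (suc k)) → accepts P w ≡ accepts P′ w)
lemma6 m (prog body final) =
  prog (target T) (renameBool (realises T) final) ,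
  λ k w → sym (renameBool-sound (realises T) final w (lastFin k))
  where open Translation m
        T = translate body
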